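{- Let $a,b\in\mathbb{Z}[i]\setminus\{0\}$ have Gauss remainder $r\neq0$ with $\phi_{\mathbb{Z}[i]}(r)\geq\phi_{\mathbb{Z}[i]}(b)=n$. Then $\ell_\infty(b)-m(b)\leq w_n-3\cdot 2^{v_2(b)}$.
   Context: $\mathbb{Z}[i]$ has norm $\mathrm{Nm}(x+yi)=x^2+y^2$. A function $f:\mathbb{Z}[i]\setminus\{0\}\to W$ ($W$ a well-ordered set having $\mathbb{N}$ as an initial segment) is Euclidean if for all nonzero $a,b$ there exist $q,r$ with $a=qb+r$ and either $r=0$ or $f(r)<f(b)$. $\phi_{\mathbb{Z}[i]}$ is the minimal Euclidean function, the pointwise minimum of all Euclidean functions (equivalently, the minimal $n$ such that $z=\sum_{j=0}^n u_j(1+i)^j$ with $u_j\in\{0,\pm1,\pm i\}$, $u_n\ne0$). Gauss remainder: write $a\bar b/\mathrm{Nm}(b)=\alpha+\beta i$; let $\lfloor x\rceil=\lfloor x\rfloor$ if $0\le x-\lfloor x\rfloor\le1/2$ and $\lceil x\rceil$ otherwise; $q=\lfloor\alpha\rceil+\lfloor\beta\rceil i$ and $r=a-qb$. $\ell_\infty(x+yi)=\max(|x|,|y|)$, $m(x+yi)=\min(|x|,|y|)$. $v_2(z)$ is the largest $j$ with $2^j\mid z$ in $\mathbb{Z}[i]$. For integers $k$, $w_{2k}=3\cdot2^k$, $w_{2k+1}=4\cdot2^k$ ($w_0=3,w_1=4,w_2=6,w_3=8,\dots$). -}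

module Defs where

open import Data.Nat as ℕ using (ℕ; zero; suc)
open import Data.Integer as ℤ using (ℤ; +_; _-_; -_; ∣_∣)
open import Data.Integer.DivMod using (_/ℕ_; _%ℕ_)
open import Data.Vec using (Vec; []; _∷_; last)
open import Data.Product using (Σ; ∃; _×_; _,_)
open import Relation.Binary.PropositionalEquality using (_≡_; _≢_)
open import Relation.Nullary using (¬_)

record 𝔾 : Set where
  constructor _+_i
  field
    re : ℤ
    im : ℤ
open 𝔾 public

0𝔾 : 𝔾
0𝔾 = (+ 0) + (+ 0) i

_+𝔾_ : 𝔾 → 𝔾 → 𝔾
(a + b i) +𝔾 (c + d i) = (a ℤ.+ c) + (b ℤ.+ d) i

_-𝔾_ : 𝔾 → 𝔾 → 𝔾
(a + b i) -𝔾 (c + d i) = (a - c) + (b - d) i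

_*𝔾_ : 𝔾 → 𝔾 → 𝔾
(a + b i) *𝔾 (c + d i) = (a ℤ.* c - b ℤ.* d) + (a ℤ.* d ℤ.+ b ℤ.* c) i

conj : 𝔾 → 𝔾
conj (a + b i) = a + (- b) i

Nm : 𝔾 → ℕ
Nm (x + y i) = ∣ x ℤ.* x ℤ.+ y ℤ.* y ∣

_∣𝔾_ : 𝔾 → 𝔾 → Set
c ∣𝔾 z = ∃ λ q → q *𝔾 c ≡ z

two^ : ℕ → 𝔾
two^ j = (+ (2 ℕ.^ j)) + (+ 0) i

IsV₂ : 𝔾 → ℕ → Set
IsV₂ z j = (two^ j ∣𝔾 z) × ¬ (two^ (suc j) ∣𝔾 z)

-- ⌊p/N⌉ : floor(p/N) if 0 ≤ frac(p/N) ≤ 1/2, else ceil(p/N)  (N > 0).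
-- With frac(p/N) = (p mod N)/N: frac ≤ 1/2 iff 2 (p mod N) ≤ N; otherwise
-- frac > 0, so ceil = floor + 1.  (N = 0 never occurs; returns 0.)
roundDiv : ℤ → ℕ → ℤ
roundDiv p zero = + 0
roundDiv p (suc k) with (2 ℕ.* (p %ℕ suc k)) ℕ.≤? suc k
... | Relation.Nullary.yes _ = p /ℕ suc k
... | Relation.Nullary.no  _ = p /ℕ suc k ℤ.+ + 1

-- Gauss quotient and remainder: a b̄ / Nm(b) = α + β i,
-- q = ⌊α⌉ + ⌊β⌉ i, r = a - q b
gaussQuot : 𝔾 → 𝔾 → 𝔾
gaussQuot a b = roundDiv (re (a *𝔾 conj b)) (Nm b) + roundDiv (im (a *𝔾 conj b)) (Nm b) i

gaussRem : 𝔾 → 𝔾 → 𝔾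
gaussRem a b = a -𝔾 (gaussQuot a b *𝔾 b)

data Digit : Set where
  d0 d1 d-1 di d-i : Digit

digit : Digit → 𝔾
digit d0  = 0𝔾
digit d1  = (+ 1) + (+ 0) i
digit d-1 = (- + 1) + (+ 0) i
digit di  = (+ 0) + (+ 1) i
digit d-i = (+ 0) + (- + 1) i

1+i : 𝔾
1+i = (+ 1) + (+ 1) i

-- Σ_j u_j (1+i)^j for the digit vector (u_0, …, u_n)
evalDigits : ∀ {k} → Vec Digit k → 𝔾
evalDigits [] = 0𝔾
evalDigits (u ∷ us) = digit u +𝔾 (1+i *𝔾 evalDigits us)

HasExpansion : 𝔾 → ℕ → Set
HasExpansion z n = Σ (Vec Digit (suc n)) λ us → (last us ≢ d0) × (evalDigits us ≡ z)

IsPhi : 𝔾 → ℕ → Set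
IsPhi z n = HasExpansion z n × (∀ k → HasExpansion z k → n ℕ.≤ k)

PhiAtLeast : 𝔾 → ℕ → Set
PhiAtLeast z n = ∀ k → HasExpansion z k → n ℕ.≤ k

-- w_{2k} = 3·2^k, w_{2k+1} = 4·2^k
w : ℕ → ℕ
w zero = 3
w (suc zero) = 4
w (suc (suc n)) = 2 ℕ.* w n

ℓ∞ : 𝔾 → ℕ
ℓ∞ (x + y i) = ∣ x ∣ ℕ.⊔ ∣ y ∣

mn : 𝔾 → ℕ
mn (x + y i) = ∣ x ∣ ℕ.⊓ ∣ y ∣

{-# OPTIONS --safe #-}
module Submission where

-- Write b = 2^v q with re q, im q not both even.  If z has an expansion with n + 1 digits and
-- (1+i)^s divides z, then |re z|, |im z| ≤ w n − w (s − 1) and |re z ± im z| ≤ w (n + 1) − w s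
-- (with w (−1) = 2): peeling off the lowest digit, multiplication by 1+i turns the bound on
-- |x ± y| into the bound on |x|, |y|, and twice the bound on |x|, |y| into the next bound on
-- |x ± y|.  For s = 2v this gives |re b|, |im b| ≤ w n − 2·2^v.  Writing these as p·2^v ≥ p'·2^v,
-- the claim is immediate if p' ≥ 1; if p' = 0 then p is odd, and since w n is 3·2^k or 2^(k+2),
-- (p + 2)·2^v ≤ w n forces (p + 3)·2^v ≤ w n unless p = 1 and n = 2v.  In that last case b is
-- 2^v times a unit, so the Gauss remainder has 2|re r|, 2|im r| ≤ 2^v, and every such element
-- is the value of 2v digits, whence φ r < 2v = n.

open import Defs
open import Data.Nat using (ℕ; _^_)
open import Data.Integer using (+_; _-_; _≤_; _*_)
open import Relation.Binary.PropositionalEquality using (_≢_)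

open import Data.Nat as ℕ using (zero; suc; z≤n; s≤s; _⊔_; _⊓_)
import Data.Nat.Properties as ℕP
open import Data.Nat.Divisibility using (_∣_; _∣0; m∣m*n)
import Data.Nat.Tactic.RingSolver as ℕ-Solver
open import Data.Integer as ℤ using (ℤ; -[1+_]; +[1+_]; -_; ∣_∣; +≤+)
import Data.Integer.Properties as ℤP
import Data.Integer.Divisibility.Signed as ℤ∣
open import Data.Integer.DivMod using (_/ℕ_; _%ℕ_; a≡a%ℕn+[a/ℕn]*n; n%ℕd<d)
open import Data.Integer.Tactic.RingSolver using (solve; solve-∀)
open import Algebra.Properties.CommutativeSemigroup ℕP.*-commutativeSemigroup
  using () renaming (x∙yz≈y∙xz to *-left-comm)
open import Algebra.Properties.CommutativeSemigroup ℤP.+-commutativeSemigroup using (interchange)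
open import Data.List using (List; []; _∷_)
open import Data.Vec using (Vec; []; _∷_; last)
open import Data.Product using (∃; ∃₂; _×_; _,_; proj₁; proj₂; swap)
open import Data.Sum as Sum using (_⊎_; inj₁; inj₂)
open import Data.Unit using (⊤; tt)
open import Data.Empty using (⊥-elim)
open import Function using (_∘_; _∋_)
open import Relation.Nullary using (¬_; Dec; yes; no)
open import Relation.Binary.PropositionalEquality
  using (_≡_; refl; sym; trans; cong; cong₂; subst; subst₂; module ≡-Reasoning)

open ≡-Reasoning

data Parity : ℕ → Set where
  even : ∀ t → Parity (2 ℕ.* t)
  odd  : ∀ t → Parity (suc (2 ℕ.* t))

parity : ∀ n → Parity n
parity zero = even 0
parity (suc n) with parity n
... | even t = odd t
... | odd t  = subst Parity (cong suc (ℕP.+-suc t (t ℕ.+ 0))) (even (suc t))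

data Trit : Set where
  0ₜ 1ₜ -1ₜ : Trit

⟦_⟧ₜ : Trit → ℤ
⟦ 0ₜ ⟧ₜ  = + 0
⟦ 1ₜ ⟧ₜ  = + 1
⟦ -1ₜ ⟧ₜ = - + 1

balanced-halving : ∀ x → ∃₂ λ c h → x ≡ ⟦ c ⟧ₜ ℤ.+ + 2 * h × 2 ℕ.* ∣ h ∣ ℕ.≤ ∣ x ∣
balanced-halving (+ n) with parity n
... | even t = 0ₜ , + t , trans (ℤP.pos-* 2 t) (sym (ℤP.+-identityˡ _)) , ℕP.≤-refl
... | odd t  = 1ₜ , + t , cong (λ k → + 1 ℤ.+ k) (ℤP.pos-* 2 t) , ℕP.n≤1+n _
balanced-halving -[1+ n ] with parity n
... | even t = -1ₜ , - + t , trans (cong (λ k → - (+ 1 ℤ.+ k)) (ℤP.pos-* 2 t)) (neg-odd (+ t))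
             , subst (λ k → 2 ℕ.* k ℕ.≤ suc (2 ℕ.* t)) (sym (ℤP.∣-i∣≡∣i∣ (+ t))) (ℕP.n≤1+n _)
  where
  neg-odd : ∀ T → - (+ 1 ℤ.+ + 2 * T) ≡ - + 1 ℤ.+ + 2 * - T
  neg-odd = solve-∀
... | odd t  = 0ₜ , -[1+ t ] , cong -[1+_] (sym (ℕP.+-suc t (t ℕ.+ 0)))
             , ℕP.≤-reflexive (cong suc (ℕP.+-suc t (t ℕ.+ 0)))

triangle : ∀ {i A B} j k → i ≡ j ℤ.+ k → + ∣ j ∣ ≤ A → + ∣ k ∣ ≤ B → + ∣ i ∣ ≤ A ℤ.+ B
triangle j k refl j≤A k≤B = ℤP.≤-trans (+≤+ (ℤP.∣i+j∣≤∣i∣+∣j∣ j k)) (ℤP.+-mono-≤ j≤A k≤B)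

+a≤+c-+b⇒a+b≤c : ∀ {a b c} → + a ≤ + c - + b → a ℕ.+ b ℕ.≤ c
+a≤+c-+b⇒a+b≤c {a} {b} {c} h =
  ℤP.drop‿+≤+ (subst (λ t → + (a ℕ.+ b) ≤ t) (cancel (+ c) (+ b)) (ℤP.+-monoˡ-≤ (+ b) h))
  where
  cancel : ∀ C B → (C - B) ℤ.+ B ≡ C
  cancel = solve-∀

a+d≤c+b⇒+a-+b≤+c-+d : ∀ {a b c d} → a ℕ.+ d ℕ.≤ c ℕ.+ b → + a - + b ≤ + c - + d
a+d≤c+b⇒+a-+b≤+c-+d {a} {b} {c} {d} h =
  subst₂ _≤_ (cancel (+ a) (+ d) (+ b)) (cancel′ (+ c) (+ b) (+ d)) (ℤP.+-monoˡ-≤ (- (+ b ℤ.+ + d)) (+≤+ h))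
  where
  cancel : ∀ A D B → (A ℤ.+ D) ℤ.+ - (B ℤ.+ D) ≡ A - B
  cancel = solve-∀
  cancel′ : ∀ C B D → (C ℤ.+ B) ℤ.+ - (B ℤ.+ D) ≡ C - D
  cancel′ = solve-∀

+[a-b]+[a-b] : ∀ a b → (+ a - + b) ℤ.+ (+ a - + b) ≡ + (2 ℕ.* a) - + (2 ℕ.* b)
+[a-b]+[a-b] a b = begin
  (+ a - + b) ℤ.+ (+ a - + b) ≡⟨ doubling (+ a) (+ b) ⟩
  + 2 * + a - + 2 * + b       ≡⟨ sym (cong₂ _-_ (ℤP.pos-* 2 a) (ℤP.pos-* 2 b)) ⟩
  + (2 ℕ.* a) - + (2 ℕ.* b)   ∎
  where
  doubling : ∀ A B → (A - B) ℤ.+ (A - B) ≡ + 2 * A - + 2 * B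
  doubling = solve-∀

1+[W-[1+C]] : ∀ W C → + 1 ℤ.+ (W - (+ 1 ℤ.+ C)) ≡ W - C
1+[W-[1+C]] = solve-∀

-- w (n - 1), with the convention w (-1) = 2
wPrev : ℕ → ℕ
wPrev zero    = 2
wPrev (suc n) = w n

w-suc : ∀ n → w (suc n) ≡ 2 ℕ.* wPrev n
w-suc zero    = refl
w-suc (suc n) = refl

wPrev-double : ∀ v → wPrev (v ℕ.* 2) ≡ 2 ℕ.* 2 ^ v
wPrev-double zero    = refl
wPrev-double (suc v) = trans (w-suc (v ℕ.* 2)) (cong (2 ℕ.*_) (wPrev-double v))

4<[3+2t]*2^[1+v] : ∀ t v → 4 ℕ.< (3 ℕ.+ 2 ℕ.* t) ℕ.* 2 ^ suc v
4<[3+2t]*2^[1+v] t v =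
  ℕP.≤-trans (ℕP.n≤1+n 5) (ℕP.*-mono-≤ (ℕP.m≤m+n 3 (2 ℕ.* t)) (ℕP.*-monoʳ-≤ 2 (ℕP.m^n>0 2 v)))

odd*2^v≤w : ∀ n v t → (3 ℕ.+ 2 ℕ.* t) ℕ.* 2 ^ v ℕ.≤ w n
  → (4 ℕ.+ 2 ℕ.* t) ℕ.* 2 ^ v ℕ.≤ w n ⊎ (t ≡ 0 × n ≡ v ℕ.* 2)
odd*2^v≤w n zero t h with ℕP.m≤n⇒m<n∨m≡n h
... | inj₁ < = inj₁ <
odd*2^v≤w zero    zero zero    h | inj₂ _  = inj₂ (refl , refl)
odd*2^v≤w zero    zero (suc t) h | inj₂ ()
odd*2^v≤w (suc n) zero t       h | inj₂ eq = ⊥-elim (ℕP.even≢odd (wPrev n) (suc t) (begin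
  2 ℕ.* wPrev n               ≡⟨ sym (w-suc n) ⟩
  w (suc n)                   ≡⟨ sym eq ⟩
  (3 ℕ.+ 2 ℕ.* t) ℕ.* 1       ≡⟨ ℕ-Solver.solve (List ℕ ∋ t ∷ []) ⟩
  suc (2 ℕ.* suc t)           ∎))
odd*2^v≤w zero          (suc v) t h = ⊥-elim (ℕP.<⇒≱ (ℕP.<-trans (ℕP.n<1+n 3) (4<[3+2t]*2^[1+v] t v)) h)
odd*2^v≤w (suc zero)    (suc v) t h = ⊥-elim (ℕP.<⇒≱ (4<[3+2t]*2^[1+v] t v) h)
odd*2^v≤w (suc (suc n)) (suc v) t h
  with odd*2^v≤w n v t (ℕP.*-cancelˡ-≤ 2 (subst (ℕ._≤ 2 ℕ.* w n) (*-left-comm (3 ℕ.+ 2 ℕ.* t) 2 (2 ^ v)) h))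
... | inj₁ le         = inj₁ (subst (ℕ._≤ 2 ℕ.* w n) (sym (*-left-comm (4 ℕ.+ 2 ℕ.* t) 2 (2 ^ v)))
                                     (ℕP.*-monoʳ-≤ 2 le))
... | inj₂ (t≡0 , n≡) = inj₂ (t≡0 , cong (suc ∘ suc) n≡)

ordered-gap : ∀ {n v p p'} → p' ℕ.≤ p → ¬ ((2 ∣ p) × (2 ∣ p')) → p ℕ.* 2 ^ v ℕ.+ 2 ℕ.* 2 ^ v ℕ.≤ w n
  → p ℕ.* 2 ^ v ℕ.+ 3 ℕ.* 2 ^ v ℕ.≤ w n ℕ.+ p' ℕ.* 2 ^ v
    ⊎ (n ≡ v ℕ.* 2 × p ℕ.* 2 ^ v ≡ 2 ^ v × p' ℕ.* 2 ^ v ≡ 0)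
ordered-gap {n} {v} {p} {suc k} _ _ h =
  inj₁ (subst (λ a → a ℕ.≤ w n ℕ.+ suc k ℕ.* 2 ^ v) (sym (+3K p (2 ^ v)))
              (ℕP.+-mono-≤ h (ℕP.m≤m+n (2 ^ v) (k ℕ.* 2 ^ v))))
  where
  +3K : ∀ a K → a ℕ.* K ℕ.+ 3 ℕ.* K ≡ (a ℕ.* K ℕ.+ 2 ℕ.* K) ℕ.+ K
  +3K = ℕ-Solver.solve-∀
ordered-gap {n} {v} {p} {zero} _ ¬evens h with parity p
... | even t = ⊥-elim (¬evens (m∣m*n t , 2 ∣0))
... | odd t  = Sum.map (subst₂ ℕ._≤_ (odd+3 t (2 ^ v)) (sym (ℕP.+-identityʳ (w n))))
                       (λ { (refl , n≡2v) → n≡2v , ℕP.*-identityˡ (2 ^ v) , refl })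
                       (odd*2^v≤w n v t (subst (ℕ._≤ w n) (odd+2 t (2 ^ v)) h))
  where
  odd+2 : ∀ t K → suc (2 ℕ.* t) ℕ.* K ℕ.+ 2 ℕ.* K ≡ (3 ℕ.+ 2 ℕ.* t) ℕ.* K
  odd+2 = ℕ-Solver.solve-∀
  odd+3 : ∀ t K → (4 ℕ.+ 2 ℕ.* t) ℕ.* K ≡ suc (2 ℕ.* t) ℕ.* K ℕ.+ 3 ℕ.* K
  odd+3 = ℕ-Solver.solve-∀

sides-gap : ∀ {n v X Y p p'} → X ≡ p ℕ.* 2 ^ v → Y ≡ p' ℕ.* 2 ^ v → ¬ ((2 ∣ p) × (2 ∣ p'))
  → X ℕ.+ 2 ℕ.* 2 ^ v ℕ.≤ w n → Y ℕ.+ 2 ℕ.* 2 ^ v ℕ.≤ w n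
  → X ⊔ Y ℕ.+ 3 ℕ.* 2 ^ v ℕ.≤ w n ℕ.+ X ⊓ Y ⊎ (n ≡ v ℕ.* 2 × X ⊔ Y ≡ 2 ^ v × X ⊓ Y ≡ 0)
sides-gap {v = v} {p = p} {p'} refl refl ¬evens hX hY with ℕP.≤-total p' p
... | inj₁ p'≤p
  rewrite ℕP.m≥n⇒m⊔n≡m (ℕP.*-monoˡ-≤ (2 ^ v) p'≤p) | ℕP.m≥n⇒m⊓n≡n (ℕP.*-monoˡ-≤ (2 ^ v) p'≤p)
  = ordered-gap {v = v} p'≤p ¬evens hX
... | inj₂ p≤p'
  rewrite ℕP.m≤n⇒m⊔n≡n (ℕP.*-monoˡ-≤ (2 ^ v) p≤p') | ℕP.m≤n⇒m⊓n≡m (ℕP.*-monoˡ-≤ (2 ^ v) p≤p')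
  = ordered-gap {v = v} p≤p' (¬evens ∘ swap) hY

1+i*-form : ∀ x y → 1+i *𝔾 (x + y i) ≡ (x - y) + (x ℤ.+ y) i
1+i*-form x y = cong₂ _+_i (solve (List ℤ ∋ x ∷ y ∷ [])) (solve (List ℤ ∋ x ∷ y ∷ []))

*-real : ∀ x y k → (x + y i) *𝔾 (k + + 0 i) ≡ (x * k) + (y * k) i
*-real x y k = cong₂ _+_i (solve (List ℤ ∋ x ∷ y ∷ k ∷ [])) (solve (List ℤ ∋ x ∷ y ∷ k ∷ []))

d0+ : ∀ z → digit d0 +𝔾 z ≡ z
d0+ (x + y i) = cong₂ _+_i (ℤP.+-identityˡ x) (ℤP.+-identityˡ y)

+𝔾-assoc : ∀ z z' z'' → (z +𝔾 z') +𝔾 z'' ≡ z +𝔾 (z' +𝔾 z'')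
+𝔾-assoc (x + y i) (x' + y' i) (x'' + y'' i) = cong₂ _+_i (ℤP.+-assoc x x' x'') (ℤP.+-assoc y y' y'')

1+i*-distrib-+𝔾 : ∀ z z' → 1+i *𝔾 (z +𝔾 z') ≡ (1+i *𝔾 z) +𝔾 (1+i *𝔾 z')
1+i*-distrib-+𝔾 (x + y i) (x' + y' i) = begin
  1+i *𝔾 ((x ℤ.+ x') + (y ℤ.+ y') i)                        ≡⟨ 1+i*-form (x ℤ.+ x') (y ℤ.+ y') ⟩
  ((x ℤ.+ x') - (y ℤ.+ y')) + ((x ℤ.+ x') ℤ.+ (y ℤ.+ y')) i ≡⟨ cong₂ _+_i (solve (List ℤ ∋ x ∷ x' ∷ y ∷ y' ∷ []))
                                                                         (solve (List ℤ ∋ x ∷ x' ∷ y ∷ y' ∷ [])) ⟩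
  ((x - y) ℤ.+ (x' - y')) + ((x ℤ.+ y) ℤ.+ (x' ℤ.+ y')) i   ≡⟨ sym (cong₂ _+𝔾_ (1+i*-form x y) (1+i*-form x' y')) ⟩
  (1+i *𝔾 (x + y i)) +𝔾 (1+i *𝔾 (x' + y' i))               ∎

[1+i]²*[y-xi] : ∀ x y → 1+i *𝔾 (1+i *𝔾 (y + (- x) i)) ≡ (+ 2 * x) + (+ 2 * y) i
[1+i]²*[y-xi] x y = begin
  1+i *𝔾 (1+i *𝔾 (y + (- x) i))                            ≡⟨ cong (1+i *𝔾_) (1+i*-form y (- x)) ⟩
  1+i *𝔾 ((y - - x) + (y ℤ.+ - x) i)                        ≡⟨ 1+i*-form (y - - x) (y ℤ.+ - x) ⟩
  ((y - - x) - (y ℤ.+ - x)) + ((y - - x) ℤ.+ (y ℤ.+ - x)) i ≡⟨ cong₂ _+_i (solve (List ℤ ∋ x ∷ y ∷ []))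
                                                                         (solve (List ℤ ∋ x ∷ y ∷ [])) ⟩
  (+ 2 * x) + (+ 2 * y) i                                   ∎

1+i*-injective : ∀ {E Z} → 1+i *𝔾 E ≡ 1+i *𝔾 Z → E ≡ Z
1+i*-injective {x + y i} {x' + y' i} eq = cong₂ _+_i
  (ℤP.*-cancelˡ-≡ (+ 2) x x' (begin
    + 2 * x                    ≡⟨ solve (List ℤ ∋ x ∷ y ∷ []) ⟩
    (x - y) ℤ.+ (x ℤ.+ y)      ≡⟨ cong₂ ℤ._+_ x-y≡ x+y≡ ⟩
    (x' - y') ℤ.+ (x' ℤ.+ y')  ≡⟨ solve (List ℤ ∋ x' ∷ y' ∷ []) ⟩
    + 2 * x'                   ∎))
  (ℤP.*-cancelˡ-≡ (+ 2) y y' (begin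
    + 2 * y                    ≡⟨ solve (List ℤ ∋ x ∷ y ∷ []) ⟩
    (x ℤ.+ y) - (x - y)        ≡⟨ cong₂ _-_ x+y≡ x-y≡ ⟩
    (x' ℤ.+ y') - (x' - y')    ≡⟨ solve (List ℤ ∋ x' ∷ y' ∷ []) ⟩
    + 2 * y'                   ∎))
  where
  eq′ : (x - y) + (x ℤ.+ y) i ≡ (x' - y') + (x' ℤ.+ y') i
  eq′ = trans (sym (1+i*-form x y)) (trans eq (1+i*-form x' y'))
  x-y≡ : x - y ≡ x' - y'
  x-y≡ = cong re eq′
  x+y≡ : x ℤ.+ y ≡ x' ℤ.+ y'
  x+y≡ = cong im eq′

digit-sum-even : ∀ p q x y x' y' → (p + q i) +𝔾 (1+i *𝔾 (x + y i)) ≡ 1+i *𝔾 (x' + y' i)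
  → p ℤ.+ q ≡ + 2 * (x' - x)
digit-sum-even p q x y x' y' eq = begin
  p ℤ.+ q                                                 ≡⟨ solve (List ℤ ∋ p ∷ q ∷ x ∷ y ∷ []) ⟩
  (p ℤ.+ (x - y)) ℤ.+ (q ℤ.+ (x ℤ.+ y)) - (x ℤ.+ x)       ≡⟨ cong (λ t → t - (x ℤ.+ x))
                                                                  (cong (λ z → re z ℤ.+ im z) eq′) ⟩
  ((x' - y') ℤ.+ (x' ℤ.+ y')) - (x ℤ.+ x)                 ≡⟨ solve (List ℤ ∋ x ∷ x' ∷ y' ∷ []) ⟩
  + 2 * (x' - x)                                          ∎
  where
  eq′ : (p + q i) +𝔾 ((x - y) + (x ℤ.+ y) i) ≡ (x' - y') + (x' ℤ.+ y') i
  eq′ = trans (cong ((p + q i) +𝔾_) (sym (1+i*-form x y))) (trans eq (1+i*-form x' y'))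

digit-sum-odd : ∀ u → u ≡ d0 ⊎ ∣ re (digit u) ℤ.+ im (digit u) ∣ ≡ 1
digit-sum-odd d0  = inj₁ refl
digit-sum-odd d1  = inj₂ refl
digit-sum-odd d-1 = inj₂ refl
digit-sum-odd di  = inj₂ refl
digit-sum-odd d-i = inj₂ refl

∣2*t∣≢1 : ∀ t → ∣ + 2 * t ∣ ≢ 1
∣2*t∣≢1 t e = ℕP.even≢odd ∣ t ∣ 0 (trans (sym (ℤP.abs-* (+ 2) t)) e)

1+i-multiple-inversion : ∀ u E Z → digit u +𝔾 (1+i *𝔾 E) ≡ 1+i *𝔾 Z → u ≡ d0 × E ≡ Z
1+i-multiple-inversion u (x + y i) (x' + y' i) eq with digit-sum-odd u
... | inj₁ refl  = refl , 1+i*-injective (trans (sym (d0+ _)) eq)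
... | inj₂ sum≡1 = ⊥-elim (∣2*t∣≢1 (x' - x)
  (trans (cong ∣_∣ (sym (digit-sum-even (re (digit u)) (im (digit u)) x y x' y' eq))) sum≡1))

1+i^_∣_ : ℕ → 𝔾 → Set
1+i^ zero  ∣ z = ⊤
1+i^ suc s ∣ z = ∃ λ z' → z ≡ 1+i *𝔾 z' × 1+i^ s ∣ z'

2k-multiple : ∀ x y k → (x * (+ 2 * k)) + (y * (+ 2 * k)) i ≡ 1+i *𝔾 (1+i *𝔾 ((y * k) + (- x * k) i))
2k-multiple x y k = begin
  (x * (+ 2 * k)) + (y * (+ 2 * k)) i       ≡⟨ cong₂ _+_i (solve (List ℤ ∋ x ∷ k ∷ [])) (solve (List ℤ ∋ y ∷ k ∷ [])) ⟩
  (+ 2 * (x * k)) + (+ 2 * (y * k)) i       ≡⟨ sym ([1+i]²*[y-xi] (x * k) (y * k)) ⟩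
  1+i *𝔾 (1+i *𝔾 ((y * k) + (- (x * k)) i)) ≡⟨ cong (λ t → 1+i *𝔾 (1+i *𝔾 ((y * k) + t i))) (ℤP.neg-distribˡ-* x k) ⟩
  1+i *𝔾 (1+i *𝔾 ((y * k) + (- x * k) i))   ∎

1+i^[2v]∣2^v* : ∀ v x y → 1+i^ (v ℕ.* 2) ∣ ((x * + 2 ^ v) + (y * + 2 ^ v) i)
1+i^[2v]∣2^v* zero    x y = tt
1+i^[2v]∣2^v* (suc v) x y =
  _ , trans (cong (λ t → (x * t) + (y * t) i) (ℤP.pos-* 2 (2 ^ v))) (2k-multiple x y (+ 2 ^ v)) ,
  _ , refl , 1+i^[2v]∣2^v* v y (- x)

not-both-even : ∀ q v → ¬ (two^ (suc v) ∣𝔾 (q *𝔾 two^ v)) → ¬ ((2 ∣ ∣ re q ∣) × (2 ∣ ∣ im q ∣))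
not-both-even (x + y i) v 2^[1+v]∤ (2∣∣x∣ , 2∣∣y∣)
  with ℤ∣.divides hx x≡hx*2 ← ℤ∣.∣ᵤ⇒∣ {+ 2} {x} 2∣∣x∣
     | ℤ∣.divides hy y≡hy*2 ← ℤ∣.∣ᵤ⇒∣ {+ 2} {y} 2∣∣y∣ = 2^[1+v]∤ (hx + hy i , (begin
  (hx + hy i) *𝔾 two^ (suc v)                 ≡⟨ *-real hx hy _ ⟩
  (hx * + 2 ^ suc v) + (hy * + 2 ^ suc v) i   ≡⟨ cong (λ t → (hx * t) + (hy * t) i) (ℤP.pos-* 2 (2 ^ v)) ⟩
  (hx * (+ 2 * k)) + (hy * (+ 2 * k)) i       ≡⟨ sym (cong₂ _+_i (ℤP.*-assoc hx (+ 2) k) (ℤP.*-assoc hy (+ 2) k)) ⟩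
  ((hx * + 2) * k) + ((hy * + 2) * k) i       ≡⟨ sym (cong₂ (λ a b → (a * k) + (b * k) i) x≡hx*2 y≡hy*2) ⟩
  (x * k) + (y * k) i                         ≡⟨ sym (*-real x y k) ⟩
  (x + y i) *𝔾 two^ v                         ∎))
  where
  k = + 2 ^ v

_≟𝔾_ : (z z' : 𝔾) → Dec (z ≡ z')
(x + y i) ≟𝔾 (x' + y' i) with x ℤ.≟ x' | y ℤ.≟ y'
... | yes refl | yes refl = yes refl
... | no x≢x'  | _        = no (x≢x' ∘ cong re)
... | yes _    | no y≢y'  = no (y≢y' ∘ cong im)

-- Expansions lie in octagons

record InOctagon (z : 𝔾) (M L : ℤ) : Set where
  constructor octagon
  field
    ∣re∣≤    : + ∣ re z ∣ ≤ M
    ∣im∣≤    : + ∣ im z ∣ ≤ M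
    ∣re+im∣≤ : + ∣ re z ℤ.+ im z ∣ ≤ L
    ∣re-im∣≤ : + ∣ re z - im z ∣ ≤ L

octagon-+ : ∀ {z z' M L M' L'} → InOctagon z M L → InOctagon z' M' L'
  → InOctagon (z +𝔾 z') (M ℤ.+ M') (L ℤ.+ L')
octagon-+ {x + y i} {x' + y' i} (octagon x≤ y≤ x+y≤ x-y≤) (octagon x'≤ y'≤ x'+y'≤ x'-y'≤) =
  octagon (triangle x x' refl x≤ x'≤) (triangle y y' refl y≤ y'≤)
    (triangle (x ℤ.+ y) (x' ℤ.+ y') (interchange x x' y y') x+y≤ x'+y'≤)
    (triangle (x - y) (x' - y') (trans (cong (λ t → (x ℤ.+ x') ℤ.+ t) (ℤP.neg-distrib-+ y y'))
                                       (interchange x x' (- y) (- y'))) x-y≤ x'-y'≤)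

octagon-1+i* : ∀ {z M L} → InOctagon z M L → InOctagon (1+i *𝔾 z) L (M ℤ.+ M)
octagon-1+i* {x + y i} {M} {L} (octagon x≤ y≤ x+y≤ x-y≤) =
  subst (λ z → InOctagon z L (M ℤ.+ M)) (sym (1+i*-form x y))
    (octagon x-y≤ x+y≤ (triangle x x (sum x y) x≤ x≤) (triangle (- y) (- y) (difference x y) -y≤ -y≤))
  where
  sum : ∀ x y → (x - y) ℤ.+ (x ℤ.+ y) ≡ x ℤ.+ x
  sum = solve-∀
  difference : ∀ x y → (x - y) - (x ℤ.+ y) ≡ - y ℤ.+ - y
  difference = solve-∀
  -y≤ : + ∣ - y ∣ ≤ M
  -y≤ = subst (λ k → + k ≤ M) (sym (ℤP.∣-i∣≡∣i∣ y)) y≤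

digit-in-octagon : ∀ u → InOctagon (digit u) (+ 1) (+ 1)
digit-in-octagon d0  = octagon (+≤+ z≤n) (+≤+ z≤n) (+≤+ z≤n) (+≤+ z≤n)
digit-in-octagon d1  = octagon ℤP.≤-refl (+≤+ z≤n) ℤP.≤-refl ℤP.≤-refl
digit-in-octagon d-1 = octagon ℤP.≤-refl (+≤+ z≤n) ℤP.≤-refl ℤP.≤-refl
digit-in-octagon di  = octagon (+≤+ z≤n) ℤP.≤-refl ℤP.≤-refl ℤP.≤-refl
digit-in-octagon d-i = octagon (+≤+ z≤n) ℤP.≤-refl ℤP.≤-refl ℤP.≤-refl

digits-in-octagon : ∀ {k} (us : Vec Digit k) → InOctagon (evalDigits us) (+ wPrev k - + 2) (+ w k - + 3)
digits-in-octagon [] = octagon ℤP.≤-refl ℤP.≤-refl ℤP.≤-refl ℤP.≤-refl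
digits-in-octagon {suc k} (u ∷ us) =
  subst₂ (InOctagon _) (1+[W-[1+C]] (+ w k) (+ 2)) diamond
    (octagon-+ (digit-in-octagon u) (octagon-1+i* (digits-in-octagon us)))
  where
  diamond : + 1 ℤ.+ ((+ wPrev k - + 2) ℤ.+ (+ wPrev k - + 2)) ≡ + w (suc k) - + 3
  diamond = begin
    + 1 ℤ.+ ((+ wPrev k - + 2) ℤ.+ (+ wPrev k - + 2)) ≡⟨ cong (λ t → + 1 ℤ.+ t) (+[a-b]+[a-b] (wPrev k) 2) ⟩
    + 1 ℤ.+ (+ (2 ℕ.* wPrev k) - + 4)                 ≡⟨ 1+[W-[1+C]] (+ (2 ℕ.* wPrev k)) (+ 3) ⟩
    + (2 ℕ.* wPrev k) - + 3                           ≡⟨ cong (λ t → + t - + 3) (sym (w-suc k)) ⟩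
    + w (suc k) - + 3                                 ∎

divisible-digits-in-octagon : ∀ {n s} (us : Vec Digit (suc n)) → last us ≢ d0 → 1+i^ s ∣ evalDigits us
  → InOctagon (evalDigits us) (+ w n - + wPrev s) (+ w (suc n) - + w s)
divisible-digits-in-octagon {s = zero} us _ _ = digits-in-octagon us
divisible-digits-in-octagon {zero} {suc s} (u ∷ []) u≢d0 (z′ , eq , _) =
  ⊥-elim (u≢d0 (proj₁ (1+i-multiple-inversion u 0𝔾 z′ eq)))
divisible-digits-in-octagon {suc n} {suc s} (u ∷ us) last≢d0 (z′ , eq , 1+i^s∣z′)
  with refl , refl ← 1+i-multiple-inversion u (evalDigits us) z′ eq =
  subst₂ (λ z L → InOctagon z (+ w (suc n) - + w s) L) (sym (d0+ _))
    (trans (+[a-b]+[a-b] (w n) (wPrev s)) (cong (λ t → + w (suc (suc n)) - + t) (sym (w-suc s))))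
    (octagon-1+i* (divisible-digits-in-octagon us last≢d0 1+i^s∣z′))

expansion-sides-bound : ∀ {z n v} → HasExpansion z n → 1+i^ (v ℕ.* 2) ∣ z
  → ∣ re z ∣ ℕ.+ 2 ℕ.* 2 ^ v ℕ.≤ w n × ∣ im z ∣ ℕ.+ 2 ℕ.* 2 ^ v ℕ.≤ w n
expansion-sides-bound {n = n} {v} (us , last≢d0 , refl) 1+i^[2v]∣z = bound ∣re∣≤ , bound ∣im∣≤
  where
  open InOctagon (divisible-digits-in-octagon us last≢d0 1+i^[2v]∣z)
  bound : ∀ {a} → + a ≤ + w n - + wPrev (v ℕ.* 2) → a ℕ.+ 2 ℕ.* 2 ^ v ℕ.≤ w n
  bound h = subst (λ c → _ ℕ.+ c ℕ.≤ w n) (wPrev-double v) (+a≤+c-+b⇒a+b≤c h)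

ℓ∞-mn-gap : ∀ {b n v} → HasExpansion b n → IsV₂ b v
  → ℓ∞ b ℕ.+ 3 ℕ.* 2 ^ v ℕ.≤ w n ℕ.+ mn b ⊎ (n ≡ v ℕ.* 2 × ℓ∞ b ≡ 2 ^ v × mn b ≡ 0)
ℓ∞-mn-gap {b} {n} {v} b-expansion ((q , q*2^v≡b) , 2^[1+v]∤b) =
  sides-gap {v = v} (trans (cong (∣_∣ ∘ re) b≡) (ℤP.abs-* (re q) (+ 2 ^ v)))
                    (trans (cong (∣_∣ ∘ im) b≡) (ℤP.abs-* (im q) (+ 2 ^ v)))
                    (not-both-even q v (2^[1+v]∤b ∘ subst (two^ (suc v) ∣𝔾_) q*2^v≡b))
                    (proj₁ sides) (proj₂ sides)
  where
  b≡ : b ≡ (re q * + 2 ^ v) + (im q * + 2 ^ v) i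
  b≡ = trans (sym q*2^v≡b) (*-real (re q) (im q) (+ 2 ^ v))
  sides = expansion-sides-bound {v = v} b-expansion
            (subst (1+i^ (v ℕ.* 2) ∣_) (sym b≡) (1+i^[2v]∣2^v* v (re q) (im q)))

-- Short expansions of small elements

trit-pair-digits : ∀ cx cy → ∃₂ λ d d' → digit d +𝔾 (1+i *𝔾 digit d') ≡ ⟦ cx ⟧ₜ + ⟦ cy ⟧ₜ i
trit-pair-digits 0ₜ  0ₜ  = d0  , d0  , refl
trit-pair-digits 1ₜ  0ₜ  = d1  , d0  , refl
trit-pair-digits -1ₜ 0ₜ  = d-1 , d0  , refl
trit-pair-digits 0ₜ  1ₜ  = di  , d0  , refl
trit-pair-digits 0ₜ  -1ₜ = d-i , d0  , refl
trit-pair-digits 1ₜ  1ₜ  = d0  , d1  , refl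
trit-pair-digits -1ₜ -1ₜ = d0  , d-1 , refl
trit-pair-digits -1ₜ 1ₜ  = d0  , di  , refl
trit-pair-digits 1ₜ  -1ₜ = d0  , d-i , refl

2∣i∣≤1⇒i≡0 : ∀ {x} → 2 ℕ.* ∣ x ∣ ℕ.≤ 1 → x ≡ + 0
2∣i∣≤1⇒i≡0 {x} h = ℤP.∣i∣≡0⇒i≡0 (ℕP.n<1⇒n≡0 (ℕP.*-cancelˡ-< 2 ∣ x ∣ 1 (s≤s h)))

short-digits : ∀ v z → 2 ℕ.* ∣ re z ∣ ℕ.≤ 2 ^ v → 2 ℕ.* ∣ im z ∣ ℕ.≤ 2 ^ v
  → ∃ λ (us : Vec Digit (v ℕ.* 2)) → evalDigits us ≡ z
short-digits zero    (x + y i) 2∣x∣≤1 2∣y∣≤1 = [] , sym (cong₂ _+_i (2∣i∣≤1⇒i≡0 2∣x∣≤1) (2∣i∣≤1⇒i≡0 2∣y∣≤1))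
short-digits (suc v) (x + y i) 2∣x∣≤2K 2∣y∣≤2K =
  let cx , hx , x≡ , 2∣hx∣≤∣x∣ = balanced-halving x
      cy , hy , y≡ , 2∣hy∣≤∣y∣ = balanced-halving y
      d , d' , dd'≡ = trit-pair-digits cx cy
      us , us≡ = short-digits v (hy + (- hx) i)
                   (ℕP.≤-trans 2∣hy∣≤∣y∣ (ℕP.*-cancelˡ-≤ 2 2∣y∣≤2K))
                   (subst (λ t → 2 ℕ.* t ℕ.≤ 2 ^ v) (sym (ℤP.∣-i∣≡∣i∣ hx))
                     (ℕP.≤-trans 2∣hx∣≤∣x∣ (ℕP.*-cancelˡ-≤ 2 2∣x∣≤2K)))
  in d ∷ d' ∷ us , (begin
    digit d +𝔾 (1+i *𝔾 (digit d' +𝔾 (1+i *𝔾 evalDigits us)))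
      ≡⟨ cong (λ E → digit d +𝔾 (1+i *𝔾 (digit d' +𝔾 (1+i *𝔾 E)))) us≡ ⟩
    digit d +𝔾 (1+i *𝔾 (digit d' +𝔾 (1+i *𝔾 (hy + (- hx) i))))
      ≡⟨ cong (digit d +𝔾_) (1+i*-distrib-+𝔾 (digit d') _) ⟩
    digit d +𝔾 ((1+i *𝔾 digit d') +𝔾 (1+i *𝔾 (1+i *𝔾 (hy + (- hx) i))))
      ≡⟨ sym (+𝔾-assoc (digit d) _ _) ⟩
    (digit d +𝔾 (1+i *𝔾 digit d')) +𝔾 (1+i *𝔾 (1+i *𝔾 (hy + (- hx) i)))
      ≡⟨ cong₂ _+𝔾_ dd'≡ ([1+i]²*[y-xi] hx hy) ⟩
    (⟦ cx ⟧ₜ + ⟦ cy ⟧ₜ i) +𝔾 ((+ 2 * hx) + (+ 2 * hy) i)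
      ≡⟨ sym (cong₂ _+_i x≡ y≡) ⟩
    x + y i ∎)

expansion-of-digits : ∀ {m z} (us : Vec Digit m) → evalDigits us ≡ z → z ≢ 0𝔾
  → ∃ λ j → j ℕ.< m × HasExpansion z j
expansion-of-digits [] refl z≢0 = ⊥-elim (z≢0 refl)
expansion-of-digits (u ∷ us) refl z≢0 with evalDigits us ≟𝔾 0𝔾
... | yes us≡0 =
  0 , s≤s z≤n ,
  (u ∷ [] , (λ u≡d0 → z≢0 (cong₂ (λ d E → digit d +𝔾 (1+i *𝔾 E)) u≡d0 us≡0)) ,
   cong (λ E → digit u +𝔾 (1+i *𝔾 E)) (sym us≡0))
... | no us≢0 =
  let j , j<m , (vs , last≢d0 , vs≡) = expansion-of-digits us refl us≢0
  in suc j , s≤s j<m , (u ∷ vs , last≢d0 , cong (λ E → digit u +𝔾 (1+i *𝔾 E)) vs≡)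

-- The Gauss remainder

2[N∸r]≤N : ∀ {N r} → N ℕ.< 2 ℕ.* r → 2 ℕ.* (N ℕ.∸ r) ℕ.≤ N
2[N∸r]≤N {N} {r} N<2r = ℕP.≤-trans (ℕP.≤-reflexive (ℕP.*-distribˡ-∸ 2 N r))
  (ℕP.m≤n+o⇒m∸n≤o (2 ℕ.* N) (2 ℕ.* r) (subst (2 ℕ.* N ℕ.≤_) (ℕP.+-comm N (2 ℕ.* r))
    (ℕP.+-monoʳ-≤ N (ℕP.≤-trans (ℕP.≤-reflexive (ℕP.+-identityʳ N)) (ℕP.<⇒≤ N<2r)))))

roundDiv-error : ∀ p N .{{_ : ℕ.NonZero N}} → 2 ℕ.* ∣ p - roundDiv p N * + N ∣ ℕ.≤ N
roundDiv-error p N@(suc _) with 2 ℕ.* (p %ℕ N) ℕ.≤? N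
... | yes 2r≤N = subst (λ t → 2 ℕ.* ∣ t ∣ ℕ.≤ N) (sym p-qN≡r) 2r≤N
  where
  round-down : ∀ R Q M → (R ℤ.+ Q * M) - Q * M ≡ R
  round-down = solve-∀
  p-qN≡r : p - p /ℕ N * + N ≡ + (p %ℕ N)
  p-qN≡r = trans (cong (λ t → t - p /ℕ N * + N) (a≡a%ℕn+[a/ℕn]*n p N)) (round-down (+ (p %ℕ N)) (p /ℕ N) (+ N))
... | no 2r≰N = subst (λ t → 2 ℕ.* t ℕ.≤ N) (sym ∣p-[q+1]N∣≡N∸r) (2[N∸r]≤N {N} {r} (ℕP.≰⇒> 2r≰N))
  where
  r = p %ℕ N
  q = p /ℕ N
  round-up : ∀ R Q M → (R ℤ.+ Q * M) - (Q ℤ.+ + 1) * M ≡ R - M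
  round-up = solve-∀
  ∣p-[q+1]N∣≡N∸r : ∣ p - (q ℤ.+ + 1) * + N ∣ ≡ N ℕ.∸ r
  ∣p-[q+1]N∣≡N∸r = begin
    ∣ p - (q ℤ.+ + 1) * + N ∣                ≡⟨ cong (λ t → ∣ t - (q ℤ.+ + 1) * + N ∣) (a≡a%ℕn+[a/ℕn]*n p N) ⟩
    ∣ (+ r ℤ.+ q * + N) - (q ℤ.+ + 1) * + N ∣ ≡⟨ cong ∣_∣ (round-up (+ r) q (+ N)) ⟩
    ∣ + r - + N ∣                            ≡⟨ cong ∣_∣ (ℤP.[+m]-[+n]≡m⊖n r N) ⟩
    ∣ r ℤ.⊖ N ∣                              ≡⟨ ℤP.∣⊖∣-≤ (ℕP.<⇒≤ (n%ℕd<d p N)) ⟩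
    N ℕ.∸ r                                  ∎

i*i≡+∣i∣*∣i∣ : ∀ i → i * i ≡ + (∣ i ∣ ℕ.* ∣ i ∣)
i*i≡+∣i∣*∣i∣ (+ n)    = ℤP.+◃n≡+n (n ℕ.* n)
i*i≡+∣i∣*∣i∣ -[1+ n ] = ℤP.+◃n≡+n (suc n ℕ.* suc n)

Nm≡∣x∣²+∣y∣² : ∀ x y → Nm (x + y i) ≡ ∣ x ∣ ℕ.* ∣ x ∣ ℕ.+ ∣ y ∣ ℕ.* ∣ y ∣
Nm≡∣x∣²+∣y∣² x y rewrite i*i≡+∣i∣*∣i∣ x | i*i≡+∣i∣*∣i∣ y = refl

+Nm≡x²+y² : ∀ x y → + Nm (x + y i) ≡ x * x ℤ.+ y * y
+Nm≡x²+y² x y = trans (cong +_ (Nm≡∣x∣²+∣y∣² x y)) (sym (cong₂ ℤ._+_ (i*i≡+∣i∣*∣i∣ x) (i*i≡+∣i∣*∣i∣ y)))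

[a-qb]b̄≡ab̄-qNb : ∀ a b q → (a -𝔾 (q *𝔾 b)) *𝔾 conj b
  ≡ (re (a *𝔾 conj b) - re q * + Nm b) + (im (a *𝔾 conj b) - im q * + Nm b) i
[a-qb]b̄≡ab̄-qNb (a₁ + a₂ i) (b₁ + b₂ i) (q₁ + q₂ i) =
  trans (cong₂ _+_i (re-part a₁ a₂ b₁ b₂ q₁ q₂) (im-part a₁ a₂ b₁ b₂ q₁ q₂))
        (cong (λ N → ((a₁ * b₁ - a₂ * - b₂) - q₁ * N) + ((a₁ * - b₂ ℤ.+ a₂ * b₁) - q₂ * N) i)
              (sym (+Nm≡x²+y² b₁ b₂)))
  where
  re-part : ∀ a₁ a₂ b₁ b₂ q₁ q₂ → (a₁ - (q₁ * b₁ - q₂ * b₂)) * b₁ - (a₂ - (q₁ * b₂ ℤ.+ q₂ * b₁)) * - b₂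
    ≡ (a₁ * b₁ - a₂ * - b₂) - q₁ * (b₁ * b₁ ℤ.+ b₂ * b₂)
  re-part = solve-∀
  im-part : ∀ a₁ a₂ b₁ b₂ q₁ q₂ → (a₁ - (q₁ * b₁ - q₂ * b₂)) * - b₂ ℤ.+ (a₂ - (q₁ * b₂ ℤ.+ q₂ * b₁)) * b₁
    ≡ (a₁ * - b₂ ℤ.+ a₂ * b₁) - q₂ * (b₁ * b₁ ℤ.+ b₂ * b₂)
  im-part = solve-∀

gaussRem-conj-bound : ∀ a b .{{_ : ℕ.NonZero (Nm b)}} →
  2 ℕ.* ∣ re (gaussRem a b *𝔾 conj b) ∣ ℕ.≤ Nm b × 2 ℕ.* ∣ im (gaussRem a b *𝔾 conj b) ∣ ℕ.≤ Nm b
gaussRem-conj-bound a b =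
  subst (λ t → 2 ℕ.* ∣ t ∣ ℕ.≤ Nm b) (sym (cong re r*b̄≡)) (roundDiv-error (re (a *𝔾 conj b)) (Nm b)) ,
  subst (λ t → 2 ℕ.* ∣ t ∣ ℕ.≤ Nm b) (sym (cong im r*b̄≡)) (roundDiv-error (im (a *𝔾 conj b)) (Nm b))
  where
  r*b̄≡ = [a-qb]b̄≡ab̄-qNb a b (gaussQuot a b)

2a≤K²⇒2c≤K : ∀ {a} c {K} .{{_ : ℕ.NonZero K}} → a ≡ c ℕ.* K → 2 ℕ.* a ℕ.≤ K ℕ.* K → 2 ℕ.* c ℕ.≤ K
2a≤K²⇒2c≤K c {K} a≡cK =
  ℕP.*-cancelʳ-≤ (2 ℕ.* c) K K ∘ subst (ℕ._≤ K ℕ.* K) (trans (cong (2 ℕ.*_) a≡cK) (sym (ℕP.*-assoc 2 c K)))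

conj-real-axis : ∀ z x → ∣ re (z *𝔾 conj (x + + 0 i)) ∣ ≡ ∣ re z ∣ ℕ.* ∣ x ∣
                       × ∣ im (z *𝔾 conj (x + + 0 i)) ∣ ≡ ∣ im z ∣ ℕ.* ∣ x ∣
conj-real-axis (r₁ + r₂ i) x =
  trans (cong (∣_∣ ∘ re) (*-real r₁ r₂ x)) (ℤP.abs-* r₁ x) ,
  trans (cong (∣_∣ ∘ im) (*-real r₁ r₂ x)) (ℤP.abs-* r₂ x)

conj-imaginary-axis : ∀ z y → ∣ re (z *𝔾 conj ((+ 0) + y i)) ∣ ≡ ∣ im z ∣ ℕ.* ∣ y ∣
                            × ∣ im (z *𝔾 conj ((+ 0) + y i)) ∣ ≡ ∣ re z ∣ ℕ.* ∣ y ∣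
conj-imaginary-axis (r₁ + r₂ i) y =
  trans (cong ∣_∣ (re-part r₁ r₂ y)) (ℤP.abs-* r₂ y) ,
  trans (cong ∣_∣ (im-part r₁ r₂ y)) (trans (ℤP.∣-i∣≡∣i∣ (r₁ * y)) (ℤP.abs-* r₁ y))
  where
  re-part : ∀ r₁ r₂ y → r₁ * + 0 - r₂ * - y ≡ r₂ * y
  re-part = solve-∀
  im-part : ∀ r₁ r₂ y → r₁ * - y ℤ.+ r₂ * + 0 ≡ - (r₁ * y)
  im-part = solve-∀

gaussRem-on-axis : ∀ a b {K} .{{_ : ℕ.NonZero K}} → ℓ∞ b ≡ K → mn b ≡ 0
  → 2 ℕ.* ∣ re (gaussRem a b) ∣ ℕ.≤ K × 2 ℕ.* ∣ im (gaussRem a b) ∣ ℕ.≤ K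
gaussRem-on-axis a (x + (+ 0) i) {K} ℓ∞≡K _ =
  halve (∣ re r ∣) (proj₁ (conj-real-axis r x)) (proj₁ (gaussRem-conj-bound a b)) ,
  halve (∣ im r ∣) (proj₂ (conj-real-axis r x)) (proj₂ (gaussRem-conj-bound a b))
  where
  b = x + (+ 0) i
  r = gaussRem a b
  ∣x∣≡K : ∣ x ∣ ≡ K
  ∣x∣≡K = trans (sym (ℕP.⊔-identityʳ ∣ x ∣)) ℓ∞≡K
  Nm≡K² : Nm b ≡ K ℕ.* K
  Nm≡K² = trans (Nm≡∣x∣²+∣y∣² x (+ 0)) (trans (ℕP.+-identityʳ _) (cong₂ ℕ._*_ ∣x∣≡K ∣x∣≡K))
  instance
    Nm≢0 : ℕ.NonZero (Nm b)
    Nm≢0 = subst ℕ.NonZero (sym Nm≡K²) (ℕP.m*n≢0 K K)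
  halve : ∀ c {t} → t ≡ c ℕ.* ∣ x ∣ → 2 ℕ.* t ℕ.≤ Nm b → 2 ℕ.* c ℕ.≤ K
  halve c t≡c∣x∣ = 2a≤K²⇒2c≤K c (trans t≡c∣x∣ (cong (c ℕ.*_) ∣x∣≡K)) ∘ subst (_ ℕ.≤_) Nm≡K²
gaussRem-on-axis a ((+ 0) + y i) {K} ℓ∞≡K _ =
  swap (halve (∣ im r ∣) (proj₁ (conj-imaginary-axis r y)) (proj₁ (gaussRem-conj-bound a b)) ,
        halve (∣ re r ∣) (proj₂ (conj-imaginary-axis r y)) (proj₂ (gaussRem-conj-bound a b)))
  where
  b = (+ 0) + y i
  r = gaussRem a b
  Nm≡K² : Nm b ≡ K ℕ.* K
  Nm≡K² = trans (Nm≡∣x∣²+∣y∣² (+ 0) y) (cong₂ ℕ._*_ ℓ∞≡K ℓ∞≡K)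
  instance
    Nm≢0 : ℕ.NonZero (Nm b)
    Nm≢0 = subst ℕ.NonZero (sym Nm≡K²) (ℕP.m*n≢0 K K)
  halve : ∀ c {t} → t ≡ c ℕ.* ∣ y ∣ → 2 ℕ.* t ℕ.≤ Nm b → 2 ℕ.* c ℕ.≤ K
  halve c t≡c∣y∣ = 2a≤K²⇒2c≤K c (trans t≡c∣y∣ (cong (c ℕ.*_) ℓ∞≡K)) ∘ subst (_ ℕ.≤_) Nm≡K²
gaussRem-on-axis a (+[1+ m ] + +[1+ n ] i) _ ()
gaussRem-on-axis a (+[1+ m ] + -[1+ n ] i) _ ()
gaussRem-on-axis a (-[1+ m ] + +[1+ n ] i) _ ()
gaussRem-on-axis a (-[1+ m ] + -[1+ n ] i) _ ()

gaussRem-short-expansion : ∀ a b v → ℓ∞ b ≡ 2 ^ v → mn b ≡ 0 → gaussRem a b ≢ 0𝔾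
  → ∃ λ j → j ℕ.< v ℕ.* 2 × HasExpansion (gaussRem a b) j
gaussRem-short-expansion a b v ℓ∞≡2^v mn≡0 r≢0 =
  let 2∣re∣≤2^v , 2∣im∣≤2^v = gaussRem-on-axis a b {{ℕP.m^n≢0 2 v}} ℓ∞≡2^v mn≡0
      us , us≡r = short-digits v (gaussRem a b) 2∣re∣≤2^v 2∣im∣≤2^v
  in expansion-of-digits us us≡r r≢0

lemma4 : (a b : 𝔾) (n v : ℕ) → a ≢ 0𝔾 → b ≢ 0𝔾
    → gaussRem a b ≢ 0𝔾
    → IsPhi b n → PhiAtLeast (gaussRem a b) n
    → IsV₂ b v
    → + ℓ∞ b - + mn b ≤ + w n - + 3 * + (2 ^ v)
lemma4 a b n v _ _ r≢0 (b-expansion , _) φ[r]≥n v₂[b]≡v with ℓ∞-mn-gap {v = v} b-expansion v₂[b]≡v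
... | inj₁ gap =
  subst (λ t → + ℓ∞ b - + mn b ≤ + w n - t) (ℤP.pos-* 3 (2 ^ v))
    (a+d≤c+b⇒+a-+b≤+c-+d {ℓ∞ b} {mn b} {w n} {3 ℕ.* 2 ^ v} gap)
... | inj₂ (n≡2v , ℓ∞≡2^v , mn≡0) with gaussRem-short-expansion a b v ℓ∞≡2^v mn≡0 r≢0
...   | j , j<2v , r-expansion = ⊥-elim (ℕP.<⇒≱ j<2v (subst (ℕ._≤ j) n≡2v (φ[r]≥n j r-expansion)))
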